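{- For every finite simple graph $H$ and every integer $r\geq 2$, $\chi\big(C_{\mathrm{Hom}_p(\mathcal{K}_r, H)}\big)\leq\chi(H)$.
   Context: All graphs are finite, simple and undirected; $\mathcal{K}_r$ denotes the complete graph on vertex set $\{1,\dots,r\}$ and $\chi$ denotes chromatic number. For a graph $H$, the Hom poset $\mathrm{Hom}_p(\mathcal{K}_r,H)$ is the set of all $r$-tuples $(A_1,\dots,A_r)$ of non-empty subsets of $V(H)$ such that for every pair $i\neq j$ in $\{1,\dots,r\}$, $A_i\times A_j\subseteq E(H)$, ordered componentwise by inclusion. The cyclic group $Z_r=\{e=\omega^0,\dots,\omega^{r-1}\}$ acts on it by cyclic shift: $\omega^i.(A_1,\dots,A_r)=(A_{1+i},\dots,A_{r+i})$, indices modulo $r$ in $\{1,\dots,r\}$. For a poset $P$ with an order-preserving action of a finite group $G$, the compatibility graph $C_P$ has vertex set $P$, with $x,y$ adjacent iff there is $g\in G\setminus\{e\}$ such that $x$ and $g.y$ are comparable in $P$. -}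

module Defs where

open import Level using (0ℓ)
open import Data.Nat using (ℕ; zero; suc; _+_; _≤_)
open import Data.Nat.DivMod using (_mod_)
open import Data.Fin using (Fin; toℕ)
open import Data.Fin.Subset using (Subset; _∈_; _⊆_; Nonempty)
open import Data.Product using (Σ; _×_; ∃; _,_; proj₁)
open import Data.Sum using (_⊎_)
open import Relation.Nullary using (¬_; Dec)
open import Relation.Binary.PropositionalEquality using (_≡_; _≢_)

record SimpleGraph (n : ℕ) : Set₁ where
  field
    Adj    : Fin n → Fin n → Set
    adj?   : ∀ u v → Dec (Adj u v)
    sym    : ∀ {u v} → Adj u v → Adj v u
    irrefl : ∀ {u} → ¬ Adj u u
open SimpleGraph public

Colorable : (V : Set) → (V → V → Set) → ℕ → Set
Colorable V R k = Σ (V → Fin k) λ c → ∀ x y → R x y → c x ≢ c y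

IsChromaticNumber : (V : Set) → (V → V → Set) → ℕ → Set
IsChromaticNumber V R k = Colorable V R k × (∀ m → Colorable V R m → k ≤ m)

IsHomTuple : ∀ {n} → SimpleGraph n → (r : ℕ) → (Fin r → Subset n) → Set
IsHomTuple H r A =
  (∀ i → Nonempty (A i)) ×
  (∀ i j → i ≢ j → ∀ u v → u ∈ A i → v ∈ A j → Adj H u v)

HomP : ∀ {n} → SimpleGraph n → ℕ → Set
HomP H r = Σ (Fin r → Subset _) (IsHomTuple H r)

_≼_ : ∀ {n r} → (Fin r → Subset n) → (Fin r → Subset n) → Set
A ≼ B = ∀ i → A i ⊆ B i

-- cyclic shift action of ω^g (g ∈ Fin r ≅ Z_r): (ω^g.A)_j = A_{j+g mod r}
shift : ∀ {n r} → Fin r → (Fin r → Subset n) → (Fin r → Subset n)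
shift {r = suc r} g A j = A ((toℕ j + toℕ g) mod suc r)

Comparable : ∀ {n r} → (Fin r → Subset n) → (Fin r → Subset n) → Set
Comparable A B = A ≼ B ⊎ B ≼ A

-- compatibility graph of Hom_p(K_r,H) under the Z_r action:
-- x ~ y iff there is g ≠ e with x and g.y comparable.
CompatAdj : ∀ {n} (H : SimpleGraph n) (r : ℕ) → HomP H r → HomP H r → Set
CompatAdj H r x y =
  ∃ λ (g : Fin r) → toℕ g ≢ 0 × Comparable (proj₁ x) (shift g (proj₁ y))

-- Pick, in every tuple (A₁,…,A_r) of Hom_p(K_r,H), a vertex of A₁ and give the
-- tuple the colour of that vertex in an optimal colouring of H. If (A_i) and
-- ω^g.(B_i) are comparable with g ≠ e, then either the vertex of A₁ lies in B_{1+g},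
-- or the vertex of B₁ lies in A_{1−g}; in both cases the two chosen vertices sit
-- in different coordinates of one tuple of Hom_p(K_r,H), so they are adjacent in H.
-- Hence choosing the vertex is a graph homomorphism C_P → H.
module Submission where

open import Defs hiding (sym)
open import Data.Nat using (ℕ; suc; _+_; _∸_; _≤_; s≤s)
open import Data.Nat.Properties using (m∸n+n≡m)
open import Data.Nat.DivMod using (_%_; _mod_; n%n≡0; m<n⇒m%n≡m)
open import Data.Fin as Fin using (Fin; toℕ; opposite)
open import Data.Fin.Properties using (toℕ-fromℕ<; toℕ-injective; toℕ<n; opposite-prop)
open import Data.Fin.Subset using (Subset; _∈_)
open import Data.Product using (_,_; proj₁; proj₂)
open import Data.Sum using (inj₁; inj₂)
open import Relation.Nullary using (contradiction)
open import Relation.Binary.PropositionalEquality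
  using (_≡_; refl; sym; cong; subst; module ≡-Reasoning)

Colorable-hom : ∀ {V W : Set} {R : V → V → Set} {S : W → W → Set} (f : V → W) →
  (∀ x y → R x y → S (f x) (f y)) → ∀ {k} → Colorable W S k → Colorable V R k
Colorable-hom f f-hom (c , c-proper) =
  (λ x → c (f x)) , λ x y Rxy → c-proper (f x) (f y) (f-hom x y Rxy)

IsChromaticNumber-hom : ∀ {V W : Set} {R : V → V → Set} {S : W → W → Set} (f : V → W) →
  (∀ x y → R x y → S (f x) (f y)) →
  ∀ {a b} → IsChromaticNumber V R a → IsChromaticNumber W S b → a ≤ b
IsChromaticNumber-hom f f-hom (_ , a-minimal) (b-colouring , _) =
  a-minimal _ (Colorable-hom f f-hom b-colouring)

module _ {n r : ℕ} where

  shift-zero : (g : Fin (suc r)) (A : Fin (suc r) → Subset n) → shift g A Fin.zero ≡ A g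
  shift-zero g A = cong A (toℕ-injective (begin
    toℕ (toℕ g mod suc r) ≡⟨ toℕ-fromℕ< _ ⟩
    toℕ g % suc r         ≡⟨ m<n⇒m%n≡m (toℕ<n g) ⟩
    toℕ g                 ∎))
    where open ≡-Reasoning

  -- suc (opposite g) is the index −(suc g) modulo suc r.
  shift-suc-opposite : (g : Fin r) (A : Fin (suc r) → Subset n) →
    shift (Fin.suc g) A (Fin.suc (opposite g)) ≡ A Fin.zero
  shift-suc-opposite g A = cong A (toℕ-injective (begin
    toℕ ((suc (toℕ (opposite g)) + suc (toℕ g)) mod suc r)
      ≡⟨ toℕ-fromℕ< _ ⟩
    (suc (toℕ (opposite g)) + suc (toℕ g)) % suc r
      ≡⟨ cong (λ m → (suc m + suc (toℕ g)) % suc r) (opposite-prop g) ⟩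
    suc (r ∸ suc (toℕ g) + suc (toℕ g)) % suc r
      ≡⟨ cong (λ m → suc m % suc r) (m∸n+n≡m (toℕ<n g)) ⟩
    suc r % suc r
      ≡⟨ n%n≡0 (suc r) ⟩
    0 ∎))
    where open ≡-Reasoning

module _ {n r : ℕ} (H : SimpleGraph n) where

  anchor : HomP H (suc r) → Fin n
  anchor (_ , nonempty , _) = proj₁ (nonempty Fin.zero)

  anchor∈ : (x : HomP H (suc r)) → anchor x ∈ proj₁ x Fin.zero
  anchor∈ (_ , nonempty , _) = proj₂ (nonempty Fin.zero)

  anchor-hom : ∀ x y → CompatAdj H (suc r) x y → Adj H (anchor x) (anchor y)
  anchor-hom _ _ (Fin.zero , g≢0 , _) = contradiction refl g≢0
  anchor-hom x y@(B , _ , B-complete) (Fin.suc g , _ , inj₁ x≼gy) =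
    B-complete (Fin.suc g) Fin.zero (λ ()) (anchor x) (anchor y)
      (subst (anchor x ∈_) (shift-zero (Fin.suc g) B) (x≼gy Fin.zero (anchor∈ x)))
      (anchor∈ y)
  anchor-hom x@(A , _ , A-complete) y@(B , _ , _) (Fin.suc g , _ , inj₂ gy≼x) =
    A-complete Fin.zero (Fin.suc (opposite g)) (λ ()) (anchor x) (anchor y)
      (anchor∈ x)
      (gy≼x (Fin.suc (opposite g))
        (subst (anchor y ∈_) (sym (shift-suc-opposite g B)) (anchor∈ y)))

corollary3p1 : ∀ {n} (H : SimpleGraph n) (r : ℕ) → 2 ≤ r →
    ∀ a b → IsChromaticNumber (HomP H r) (CompatAdj H r) a →
    IsChromaticNumber (Fin n) (Adj H) b → a ≤ b
corollary3p1 H (suc r) (s≤s _) a b χ-compat χ-H =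
  IsChromaticNumber-hom (anchor H) (anchor-hom H) χ-compat χ-H
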